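{- Let $M$ be an $R\times V$ boolean matrix representation of the simplicial complex $\mathcal{H}=(V,H)$. Let $M'$ be the matrix obtained from $M$ by removing repeated columns (keeping one column from each set of equal columns). Then $M'$ is a boolean matrix representation of the simplification $\mathcal{H}_S$ (where the columns of $M'$ are identified with the $\eta$-classes of $V$).
   Context: A (finite) simplicial complex is a pair $\mathcal{H}=(V,H)$ with $V$ finite nonempty and $H\subseteq 2^V$ containing all singletons and closed under subsets. A boolean matrix with row set $R$ and column set $V$ is nonsingular if, after independently permuting rows and columns, it is square lower unitriangular; $X\subseteq V$ is $M$-independent if some submatrix $M[Y,X]$ ($Y\subseteq R$) is nonsingular; $M$ is a boolean matrix representation of $\mathcal{H}$ if $H$ is exactly the set of $M$-independent subsets. A flat is a set $X\subseteq V$ with $I\cup\{p\}\in H$ for all $I\in H$, $I\subseteq X$, $p\in V\setminus X$; $\overline{X}$ is the intersection of flats containing $X$. The equivalence $\eta$ on $V$ is $a\,\eta\,b$ iff $\overline{\{a\}}=\overline{\{b\}}$ (for a represented complex, this holds iff columns $a$ and $b$ of $M$ are equal). The simplification is $\mathcal{H}_S=(V/\eta,H/\eta)$ with $H/\eta=\{\{a_1\eta,\ldots,a_k\eta\}:\{a_1,\ldots,a_k\}\in H\}$. -}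

module Defs where

open import Data.Nat using (ℕ; suc)
open import Data.Fin using (Fin; _<_)
open import Data.Fin.Subset using (Subset; _∈_; _∉_; _⊆_; _∪_; ⁅_⁆)
open import Data.Bool using (Bool; true; false)
open import Data.Product using (Σ; ∃; ∃-syntax; _×_)
open import Function.Definitions using (Injective)
open import Relation.Binary.PropositionalEquality using (_≡_)

Matrix : ℕ → ℕ → Set
Matrix r n = Fin r → Fin n → Bool

infix 3 _↔_
_↔_ : Set → Set → Set
A ↔ B = (A → B) × (B → A)

Family : ℕ → Set₁
Family n = Subset n → Set

-- (Fin n, H) is a simplicial complex: contains all singletons, closed under subsets.
-- (V = Fin n nonempty is imposed separately by n = suc _.)
IsSimplicialComplex : {n : ℕ} → Family n → Set
IsSimplicialComplex {n} H =
  ((v : Fin n) → H ⁅ v ⁆) × ((X Y : Subset n) → X ⊆ Y → H Y → H X)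

-- M[Y,X] nonsingular for Y = image of f, X = image of g, with the orderings
-- f, g making it square lower unitriangular: diagonal entries 1, entries
-- above the diagonal (row i, column j, i < j) equal to 0.
-- X is M-independent iff such a nonsingular square submatrix with column set X exists.
Independent : {r n : ℕ} → Matrix r n → Subset n → Set
Independent {r} {n} M X =
  Σ ℕ λ k → Σ (Fin k → Fin r) λ f → Σ (Fin k → Fin n) λ g →
    Injective _≡_ _≡_ f × Injective _≡_ _≡_ g
    × ((v : Fin n) → (v ∈ X) ↔ (∃[ i ] g i ≡ v))
    × ((i : Fin k) → M (f i) (g i) ≡ true)
    × ((i j : Fin k) → i < j → M (f i) (g j) ≡ false)

IsRepresentation : {r n : ℕ} → Matrix r n → Family n → Set
IsRepresentation {r} {n} M H = (X : Subset n) → H X ↔ Independent M X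

IsFlat : {n : ℕ} → Family n → Subset n → Set
IsFlat {n} H X =
  (I : Subset n) → H I → I ⊆ X → (p : Fin n) → p ∉ X → H (I ∪ ⁅ p ⁆)

InClosure : {n : ℕ} → Family n → Subset n → Fin n → Set
InClosure {n} H X v = (F : Subset n) → IsFlat H F → X ⊆ F → v ∈ F

η : {n : ℕ} → Family n → Fin n → Fin n → Set
η {n} H a b = (v : Fin n) →
  (InClosure H ⁅ a ⁆ v → InClosure H ⁅ b ⁆ v) × (InClosure H ⁅ b ⁆ v → InClosure H ⁅ a ⁆ v)

-- q : Fin n → Fin m presents Fin m as the quotient V/η:
-- q is surjective and identifies exactly the η-related vertices.
IsQuotientBy : {n m : ℕ} → (Fin n → Fin n → Set) → (Fin n → Fin m) → Set
IsQuotientBy {n} {m} E q =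
  ((c : Fin m) → ∃[ a ] q a ≡ c)
  × ((a b : Fin n) → (q a ≡ q b → E a b) × (E a b → q a ≡ q b))

QuotientFamily : {n m : ℕ} → Family n → (Fin n → Fin m) → Family m
QuotientFamily {n} {m} H q Y =
  Σ (Subset n) λ X → H X × ((c : Fin m) → (c ∈ Y) ↔ (∃[ a ] (a ∈ X × q a ≡ c)))

-- M' : keep only the columns s c, one representative per class.
selectColumns : {r n m : ℕ} → Matrix r n → (Fin m → Fin n) → Matrix r m
selectColumns M s i c = M i (s c)

-- In a represented complex the zero set of every row is a flat: an independent set I inside it
-- together with a column p where the row has a 1 is again independent, by bordering the
-- unitriangular submatrix of I with that row and column. Since η-equivalent columns lie in the
-- same flats, they are equal. Hence both q and its section s map every column to an equal
-- column, and such a column map transports unitriangular submatrices: faces of H map to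
-- M'-independent sets along q, and M'-independent sets map to faces of H along s.
module Submission where

open import Defs
open import Data.Nat using (ℕ; suc; s≤s)
open import Data.Fin using (Fin; zero; suc; _<_)
open import Data.Fin.Properties using (any?; <-cmp; _≟_)
open import Data.Fin.Subset using (Subset; _∈_; _⊆_; _∪_; ⁅_⁆)
open import Data.Fin.Subset.Properties using (_∈?_; x∈p∪q⁻; x∈p∪q⁺; x∈⁅x⁆; x∈⁅y⁆⇒x≡y)
open import Data.Vec using (tabulate)
open import Data.Vec.Properties using (lookup∘tabulate; []=⇒lookup; lookup⇒[]=)
open import Data.Vec.Functional using (_∷_)
open import Data.Bool using (true; false)
import Data.Bool as Bool
open import Data.Bool.Properties using (¬-not)
open import Data.Product using (∃-syntax; _×_; _,_; proj₁; proj₂; swap)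
open import Data.Sum using (inj₁; inj₂)
open import Function using (_∘_)
open import Function.Definitions using (Injective)
open import Relation.Nullary using (yes; no; does; contradiction)
open import Relation.Nullary.Decidable using (dec-true; _×-dec_)
open import Relation.Unary using (Decidable)
open import Relation.Binary using (tri<; tri≈; tri>)
open import Relation.Binary.PropositionalEquality using (_≡_; _≢_; refl; sym; trans; cong; subst)

private
  variable
    r n m k : ℕ

true≢false : true ≢ false
true≢false ()

subsetOf : {P : Fin n → Set} → Decidable P → Subset n
subsetOf P? = tabulate (λ v → does (P? v))

∈-subsetOf : {P : Fin n → Set} (P? : Decidable P) {v : Fin n} → (v ∈ subsetOf P?) ↔ P v
∈-subsetOf {P = P} P? {v} = to , from
  where
  to : v ∈ subsetOf P? → P v
  to v∈P with P? v | trans (sym (lookup∘tabulate (does ∘ P?) v)) ([]=⇒lookup v∈P)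
  ... | yes Pv | _ = Pv
  ... | no _ | ()
  from : P v → v ∈ subsetOf P?
  from Pv = lookup⇒[]= v _ (trans (lookup∘tabulate (does ∘ P?) v) (dec-true (P? v) Pv))

image : (Fin n → Fin m) → Subset n → Subset m
image h X = subsetOf (λ c → any? (λ a → (a ∈? X) ×-dec (h a ≟ c)))

∈-image : (h : Fin n → Fin m) (X : Subset n) {c : Fin m} → (c ∈ image h X) ↔ (∃[ a ] (a ∈ X × h a ≡ c))
∈-image h X = ∈-subsetOf (λ c → any? (λ a → (a ∈? X) ×-dec (h a ≟ c)))

image-of-section : {q : Fin n → Fin m} {s : Fin m → Fin n} → (∀ c → q (s c) ≡ c) →
                   (Y : Subset m) (c : Fin m) → (c ∈ Y) ↔ (∃[ a ] (a ∈ image s Y × q a ≡ c))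
image-of-section {q = q} {s} q∘s≗id Y c = to , from
  where
  to : c ∈ Y → ∃[ a ] (a ∈ image s Y × q a ≡ c)
  to c∈Y = s c , proj₂ (∈-image s Y) (c , c∈Y , refl) , q∘s≗id c
  from : ∃[ a ] (a ∈ image s Y × q a ≡ c) → c ∈ Y
  from (a , a∈sY , qa≡c) with proj₁ (∈-image s Y) a∈sY
  ... | c′ , c′∈Y , refl = subst (_∈ Y) (trans (sym (q∘s≗id c′)) qa≡c) c′∈Y

injective-if-<-distinct : {A : Set} (h : Fin k → A) → (∀ {i j} → i < j → h i ≢ h j) → Injective _≡_ _≡_ h
injective-if-<-distinct h distinct {i} {j} hi≡hj with <-cmp i j
... | tri< i<j _ _ = contradiction hi≡hj (distinct i<j)
... | tri≈ _ i≡j _ = i≡j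
... | tri> _ _ j<i = contradiction (sym hi≡hj) (distinct j<i)

Unitriangular : Matrix r n → (Fin k → Fin r) → (Fin k → Fin n) → Set
Unitriangular M f g = (∀ i → M (f i) (g i) ≡ true) × (∀ i j → i < j → M (f i) (g j) ≡ false)

module _ {M : Matrix r n} {f : Fin k → Fin r} {g : Fin k → Fin n} where

  unitriangular-rows-injective : Unitriangular M f g → Injective _≡_ _≡_ f
  unitriangular-rows-injective (diag , upper) = injective-if-<-distinct f λ {i} {j} i<j fi≡fj →
    true≢false (trans (sym (diag j)) (trans (cong (λ x → M x (g j)) (sym fi≡fj)) (upper i j i<j)))

  unitriangular-columns-injective : Unitriangular M f g → Injective _≡_ _≡_ g
  unitriangular-columns-injective (diag , upper) = injective-if-<-distinct g λ {i} {j} i<j gi≡gj →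
    true≢false (trans (sym (diag i)) (trans (cong (M (f i)) gi≡gj) (upper i j i<j)))

  unitriangular⇒independent : {X : Subset n} → Unitriangular M f g → (∀ v → (v ∈ X) ↔ (∃[ i ] g i ≡ v)) →
                              Independent M X
  unitriangular⇒independent U@(diag , upper) X≈g =
    _ , f , g , unitriangular-rows-injective U , unitriangular-columns-injective U , X≈g , diag , upper

zeroes : Matrix r n → Fin r → Subset n
zeroes M i = subsetOf (λ v → M i v Bool.≟ false)

∈-zeroes : (M : Matrix r n) (i : Fin r) {v : Fin n} → (v ∈ zeroes M i) ↔ (M i v ≡ false)
∈-zeroes M i = ∈-subsetOf (λ v → M i v Bool.≟ false)

independent-∪-⁅⁆ : {M : Matrix r n} {I : Subset n} {i : Fin r} {p : Fin n} →
                   Independent M I → I ⊆ zeroes M i → M i p ≡ true → Independent M (I ∪ ⁅ p ⁆)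
independent-∪-⁅⁆ {M = M} {I} {i} {p} (_ , f , g , _ , _ , I≈g , diag , upper) I⊆zeroes Mip≡true =
  unitriangular⇒independent {M = M} {f = i ∷ f} {g = p ∷ g} (diag′ , upper′) I∪p≈g′
  where
  g-zero : ∀ j → M i (g j) ≡ false
  g-zero j = proj₁ (∈-zeroes M i) (I⊆zeroes (proj₂ (I≈g (g j)) (j , refl)))
  diag′ : ∀ j → M ((i ∷ f) j) ((p ∷ g) j) ≡ true
  diag′ zero = Mip≡true
  diag′ (suc j) = diag j
  upper′ : ∀ j l → j < l → M ((i ∷ f) j) ((p ∷ g) l) ≡ false
  upper′ zero (suc l) _ = g-zero l
  upper′ (suc j) (suc l) (s≤s j<l) = upper j l j<l
  I∪p≈g′ : ∀ v → (v ∈ I ∪ ⁅ p ⁆) ↔ (∃[ j ] (p ∷ g) j ≡ v)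
  I∪p≈g′ v = to , from
    where
    to : v ∈ I ∪ ⁅ p ⁆ → ∃[ j ] (p ∷ g) j ≡ v
    to v∈I∪p with x∈p∪q⁻ I ⁅ p ⁆ v∈I∪p
    ... | inj₁ v∈I = let j , gj≡v = proj₁ (I≈g v) v∈I in suc j , gj≡v
    ... | inj₂ v∈p = zero , sym (x∈⁅y⁆⇒x≡y p v∈p)
    from : ∃[ j ] (p ∷ g) j ≡ v → v ∈ I ∪ ⁅ p ⁆
    from (zero , refl) = x∈p∪q⁺ (inj₂ (x∈⁅x⁆ p))
    from (suc j , gj≡v) = x∈p∪q⁺ (inj₁ (proj₂ (I≈g v) (j , gj≡v)))

module _ {M : Matrix r n} {H : Family n} (rep : IsRepresentation M H) where

  zeroes-isFlat : (i : Fin r) → IsFlat H (zeroes M i)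
  zeroes-isFlat i I HI I⊆zeroes p p∉zeroes =
    proj₂ (rep _) (independent-∪-⁅⁆ {M = M} {i = i} (proj₁ (rep I) HI) I⊆zeroes Mip≡true)
    where
    Mip≡true : M i p ≡ true
    Mip≡true = ¬-not (p∉zeroes ∘ proj₂ (∈-zeroes M i))

  η-preserves-zeroes : {a b : Fin n} → η H a b → (i : Fin r) → M i a ≡ false → M i b ≡ false
  η-preserves-zeroes {a} {b} a≈b i Mia≡false =
    proj₁ (∈-zeroes M i) (proj₂ (a≈b b) b∈cl⁅b⁆ (zeroes M i) (zeroes-isFlat i) ⁅a⁆⊆zeroes)
    where
    b∈cl⁅b⁆ : InClosure H ⁅ b ⁆ b
    b∈cl⁅b⁆ _ _ ⁅b⁆⊆F = ⁅b⁆⊆F (x∈⁅x⁆ b)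
    ⁅a⁆⊆zeroes : ⁅ a ⁆ ⊆ zeroes M i
    ⁅a⁆⊆zeroes x∈⁅a⁆ = subst (_∈ zeroes M i) (sym (x∈⁅y⁆⇒x≡y a x∈⁅a⁆)) (proj₂ (∈-zeroes M i) Mia≡false)

  η⇒equal-columns : {a b : Fin n} → η H a b → (i : Fin r) → M i a ≡ M i b
  η⇒equal-columns {a} {b} a≈b i with M i a in Mia | M i b in Mib
  ... | false | false = refl
  ... | true | true = refl
  ... | false | true = contradiction (trans (sym Mib) (η-preserves-zeroes a≈b i Mia)) true≢false
  ... | true | false = contradiction (trans (sym Mia) (η-preserves-zeroes (swap ∘ a≈b) i Mib)) true≢false

independent-along : {M : Matrix r n} {N : Matrix r m} (h : Fin n → Fin m) → (∀ i v → N i (h v) ≡ M i v) →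
                    {X : Subset n} {Y : Subset m} → (∀ c → (c ∈ Y) ↔ (∃[ a ] (a ∈ X × h a ≡ c))) →
                    Independent M X → Independent N Y
independent-along {N = N} h N∘h≡M {Y = Y} Y≈hX (_ , f , g , _ , _ , X≈g , diag , upper) =
  unitriangular⇒independent {M = N} {f = f} {g = h ∘ g} (diag′ , upper′) Y≈hg
  where
  diag′ : ∀ j → N (f j) (h (g j)) ≡ true
  diag′ j = trans (N∘h≡M _ _) (diag j)
  upper′ : ∀ i j → i < j → N (f i) (h (g j)) ≡ false
  upper′ i j i<j = trans (N∘h≡M _ _) (upper i j i<j)
  Y≈hg : ∀ c → (c ∈ Y) ↔ (∃[ j ] h (g j) ≡ c)
  Y≈hg c = to , from
    where
    to : c ∈ Y → ∃[ j ] h (g j) ≡ c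
    to c∈Y with proj₁ (Y≈hX c) c∈Y
    ... | a , a∈X , ha≡c with proj₁ (X≈g a) a∈X
    ... | j , refl = j , ha≡c
    from : ∃[ j ] h (g j) ≡ c → c ∈ Y
    from (j , hgj≡c) = proj₂ (Y≈hX c) (g j , proj₂ (X≈g (g j)) (j , refl) , hgj≡c)

proposition4p3 : (r n' : ℕ) → (M : Matrix r (suc n')) → (H : Family (suc n'))
    → IsSimplicialComplex H → IsRepresentation M H
    → (m : ℕ) → (q : Fin (suc n') → Fin m) → IsQuotientBy (η H) q
    → (s : Fin m → Fin (suc n')) → ((c : Fin m) → q (s c) ≡ c)
    → IsRepresentation (selectColumns M s) (QuotientFamily H q)
proposition4p3 r n' M H _ rep m q (_ , q≡⇔η) s q∘s≗id Y = face⇒independent , independent⇒face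
  where
  M′∘q≡M : ∀ i v → selectColumns M s i (q v) ≡ M i v
  M′∘q≡M i v = η⇒equal-columns rep (proj₁ (q≡⇔η (s (q v)) v) (q∘s≗id (q v))) i
  face⇒independent : QuotientFamily H q Y → Independent (selectColumns M s) Y
  face⇒independent (X , HX , Y≈qX) =
    independent-along {M = M} {N = selectColumns M s} q M′∘q≡M Y≈qX (proj₁ (rep X) HX)
  independent⇒face : Independent (selectColumns M s) Y → QuotientFamily H q Y
  independent⇒face indY =
    image s Y
    , proj₂ (rep _) (independent-along {M = selectColumns M s} {N = M} s (λ _ _ → refl)
                                       (λ _ → ∈-image s Y) indY)
    , image-of-section q∘s≗id Y
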